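{- For every $K\in\mathbb{N}$, every inquisitive S5 structure $\mathcal{M}=(W,(\Sigma_a)_{a\in\mathcal{A}},V)$ admits a finite bisimilar covering $\pi:\hat{\mathcal{M}}\to\mathcal{M}$ by an inquisitive S5 structure $\hat{\mathcal{M}}$ that is $K$-rich.
   Context: An inquisitive S5 structure over atoms $\mathcal{P}$ and agents $\mathcal{A}$ is $\mathcal{M}=(W,(\Sigma_a)_{a\in\mathcal{A}},V)$ with $V:\mathcal{P}\to\wp(W)$ and each $\Sigma_a(w)$ a non-empty, subset-closed family of subsets of $W$, such that with $\sigma_a(w):=\bigcup\Sigma_a(w)$: $w\in\sigma_a(w)$, and $v\in\sigma_a(w)$ implies $\Sigma_a(v)=\Sigma_a(w)$. Then $R_a=\{(w,v):v\in\sigma_a(w)\}$ is an equivalence relation with classes $[w]_a=\sigma_a(w)$. Bisimilarity $\sim$ between worlds of such structures: in the game, from a world-position $(w,w')$ player I chooses an agent $a$ and a state in $\Sigma_a(w)$ or $\Sigma'_a(w')$ and II replies with a state in the other; from a state-position $(s,s')$ I picks a world in $s$ or $s'$ and II replies with a world in the other. Stuck players lose; II loses at world-positions disagreeing on an atom; otherwise (including infinite plays) II wins. $w\sim w'$ iff II has a winning strategy from $(w,w')$. A relation $Y\subseteq W\times W'$ is a world-bisimulation if whenever $wYw'$, $w,w'$ agree on all atoms and for every $a$, every $s\in\Sigma_a(w)$ has some $s'\in\Sigma'_a(w')$ with $s\overline Ys'$ and conversely, where $s\overline Ys'$ means every element of $s$ is $Y$-related to some element of $s'$ and every element of $s'$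 to some element of $s$. A bisimilar covering $\pi:\hat{\mathcal{M}}\to\mathcal{M}$ by $\hat{\mathcal{M}}=(\hat W,(\hat\Sigma_a),\hat V)$ is a surjection $\pi:\hat W\to W$ such that $\{\pi(t):t\in\hat\Sigma_a(\hat w)\}=\Sigma_a(\pi(\hat w))$ for all $\hat w,a$ (where $\pi(t)=\{\pi(u):u\in t\}$), $\pi(\hat V(p))=V(p)$ for all $p$, and the graph $\{(\hat w,\pi(\hat w))\}$ of $\pi$ is a world-bisimulation. It is finite if every fibre $\pi^{ -1}(w)$ is finite. $\hat{\mathcal{M}}$ is $K$-rich if for every agent $a$, every world $w$ and every $s\in\hat\Sigma_a(w)$ there is $s'$ with $s\subseteq s'\in\hat\Sigma_a(w)$ such that for every $\sim$-class $c$ of worlds of $\hat{\mathcal{M}}$ (bisimulation type within $\hat{\mathcal{M}}$) that meets $[w]_a$, either $|c\cap s'|\ge K$ or $c\cap s'=\emptyset$. -}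

module Defs where

open import Level using (Level; _⊔_) renaming (suc to lsuc; zero to lzero)
open import Data.Nat using (ℕ)
open import Data.Fin using (Fin)
open import Data.Product using (Σ; ∃; ∃-syntax; _×_; _,_)
open import Function.Bundles using (_⇔_)
open import Function.Definitions using (Injective)
open import Relation.Binary.PropositionalEquality using (_≡_)

Subset : Set → Set₁
Subset W = W → Set

_⊆_ : {W : Set} → Subset W → Subset W → Set
s ⊆ t = ∀ w → s w → t w

_≐_ : {W : Set} → Subset W → Subset W → Set
s ≐ t = (s ⊆ t) × (t ⊆ s)

image : {W W' : Set} → (W → W') → Subset W → Subset W'
image π t = λ w → ∃[ u ] (t u × π u ≡ w)

record InqS5 (A P : Set) : Set₁ where
  field
    W  : Set
    Σa : A → W → Subset W → Set
    V  : P → Subset W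
    nonempty     : ∀ a w → ∃[ s ] Σa a w s
    subsetClosed : ∀ a w s t → Σa a w s → t ⊆ s → Σa a w t
  σ : A → W → W → Set₁
  σ a w v = ∃[ s ] (Σa a w s × s v)
  field
    reflexive : ∀ a w → σ a w w
    uniform   : ∀ a w v → σ a w v → ∀ s → (Σa a v s ⇔ Σa a w s)

open InqS5

-- Bisimilarity via the game: II has a winning strategy from (w,w') iff (w,w')
-- lies in a "winning region", i.e. a set of world-positions and state-positions
-- such that no world-position in it disagrees on an atom, and from every position
-- in it each move of player I has a reply of player II staying inside it.
record WinRegion {A P : Set} (M M' : InqS5 A P) : Set₂ where
  field
    Yw : W M → W M' → Set₁
    Ys : Subset (W M) → Subset (W M') → Set₁
    atoms : ∀ {w w'} → Yw w w' → ∀ p → (V M p w ⇔ V M' p w')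
    forth : ∀ {w w'} → Yw w w' → ∀ a s → Σa M a w s →
              ∃[ s' ] (Σa M' a w' s' × Ys s s')
    back  : ∀ {w w'} → Yw w w' → ∀ a s' → Σa M' a w' s' →
              ∃[ s ] (Σa M a w s × Ys s s')
    sforth : ∀ {s s'} → Ys s s' → ∀ v → s v → ∃[ v' ] (s' v' × Yw v v')
    sback  : ∀ {s s'} → Ys s s' → ∀ v' → s' v' → ∃[ v ] (s v × Yw v v')

Bisimilar : {A P : Set} (M M' : InqS5 A P) → W M → W M' → Set₂
Bisimilar M M' w w' = Σ (WinRegion M M') λ R → WinRegion.Yw R w w'

Lift : {W W' : Set} → (W → W' → Set) → Subset W → Subset W' → Set
Lift Y s s' = (∀ v → s v → ∃[ v' ] (s' v' × Y v v'))
            × (∀ v' → s' v' → ∃[ v ] (s v × Y v v'))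

IsWorldBisim : {A P : Set} (M M' : InqS5 A P) → (W M → W M' → Set) → Set₁
IsWorldBisim {A} {P} M M' Y = ∀ w w' → Y w w' →
    (∀ p → (V M p w ⇔ V M' p w'))
  × (∀ a → (∀ s → Σa M a w s → ∃[ s' ] (Σa M' a w' s' × Lift Y s s'))
         × (∀ s' → Σa M' a w' s' → ∃[ s ] (Σa M a w s × Lift Y s s')))

record IsBisimCovering {A P : Set} (M̂ M : InqS5 A P) (π : W M̂ → W M) : Set₁ where
  field
    surjective : ∀ w → ∃[ ŵ ] (π ŵ ≡ w)
    -- {π(t) : t ∈ Σ̂_a(ŵ)} = Σ_a(π ŵ)  (as families of sets, up to extensional equality)
    statesForth : ∀ a ŵ t → Σa M̂ a ŵ t → Σa M a (π ŵ) (image π t)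
    statesBack  : ∀ a ŵ s → Σa M a (π ŵ) s → ∃[ t ] (Σa M̂ a ŵ t × (image π t ≐ s))
    valuation   : ∀ p → image π (V M̂ p) ≐ V M p
    graphBisim  : IsWorldBisim M̂ M (λ ŵ w → π ŵ ≡ w)

FiniteFibres : {X Y : Set} → (X → Y) → Set
FiniteFibres {X} {Y} π = ∀ y → ∃[ n ] Σ (Fin n → X) λ f →
  (∀ i → π (f i) ≡ y) × (∀ x → π x ≡ y → ∃[ i ] (f i ≡ x))

AtLeast : {ℓ : Level} {X : Set} → ℕ → (X → Set ℓ) → Set ℓ
AtLeast {X = X} K c = Σ (Fin K → X) λ f → Injective _≡_ _≡_ f × (∀ i → c (f i))

-- K-richness; the ∼-class c is given by a representative u ∈ [w]_a
-- (so c meets [w]_a), c = {v | u ∼ v}.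
Rich : {A P : Set} → ℕ → InqS5 A P → Set₂
Rich K M = ∀ a w s → Σa M a w s →
  ∃[ s' ] ((s ⊆ s') × Σa M a w s' ×
    (∀ u → σ M a w u →
       let c∩s' = λ v → Bisimilar M M u v × s' v in
       (∃[ v ] c∩s' v) → AtLeast K c∩s'))

{-# OPTIONS --safe #-}
-- Replace every world by copies indexed by a pointed set I, and admit a state at a copy
-- exactly when its projection is admissible at the original world. Since Σ̂ and V̂ at a
-- copy only depend on the world it copies, all copies of a world are bisimilar, so every
-- bisimilarity class is a union of whole fibres. Enlarging a state s to the preimage of
-- its projection keeps it admissible, and then it meets each class in at least |I| points;
-- with I = Fin (K + 1) this gives K-richness and finite fibres.
module Submission where

open import Defs
open import Data.Nat using (ℕ; suc)
open import Data.Product using (Σ; ∃-syntax; _×_; _,_; proj₁; proj₂)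
open import Data.Fin using (Fin; zero)
open import Data.Fin.Properties using (suc-injective)
open import Function using (id)
open import Function.Bundles using (mk⇔; Equivalence)
open import Function.Definitions using (Injective)
open import Relation.Binary.PropositionalEquality using (_≡_; refl; sym; cong; subst)
open InqS5

preimage : {X Y : Set} → (X → Y) → Subset Y → Subset X
preimage π s = λ x → s (π x)

image-mono : {X Y : Set} (π : X → Y) {s t : Subset X} → t ⊆ s → image π t ⊆ image π s
image-mono π t⊆s y (x , tx , eq) = x , t⊆s x tx , eq

image-preimage-⊆ : {X Y : Set} (π : X → Y) (s : Subset Y) → image π (preimage π s) ⊆ s
image-preimage-⊆ π s y (x , sπx , eq) = subst s eq sπx

⊆-image-preimage-proj₁ : {X I : Set} → I → (s : Subset X) →
                         s ⊆ image (proj₁ {B = λ _ → I}) (preimage proj₁ s)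
⊆-image-preimage-proj₁ i₀ s x sx = (x , i₀) , sx , refl

Σa-image-preimage : {A P : Set} (M : InqS5 A P) {X : Set} (π : X → W M) →
                    ∀ a w s → Σa M a w s → Σa M a w (image π (preimage π s))
Σa-image-preimage M π a w s h = subsetClosed M a w s _ h (image-preimage-⊆ π s)

proj₁-finiteFibres : {X : Set} (n : ℕ) → FiniteFibres (proj₁ {A = X} {B = λ _ → Fin n})
proj₁-finiteFibres n y = n , (λ i → y , i) , (λ i → refl) , λ { (x , i) refl → i , refl }

module Inflation {A P : Set} (M : InqS5 A P) (I : Set) where

  Ŵ : Set
  Ŵ = W M × I

  π : Ŵ → W M
  π = proj₁

  M̂ : InqS5 A P
  M̂ = record
    { W = Ŵ
    ; Σa = λ a ŵ t → Σa M a (π ŵ) (image π t)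
    ; V = λ p ŵ → V M p (π ŵ)
    ; nonempty = λ a ŵ → let (s , h) = nonempty M a (π ŵ) in
        preimage π s , Σa-image-preimage M π a (π ŵ) s h
    ; subsetClosed = λ a ŵ s t h t⊆s → subsetClosed M a (π ŵ) (image π s) (image π t) h
        (image-mono π t⊆s)
    ; reflexive = λ a ŵ → let (s , h , sw) = reflexive M a (π ŵ) in
        preimage π s , Σa-image-preimage M π a (π ŵ) s h , sw
    ; uniform = λ { a ŵ v̂ (t , h , tv) s →
        uniform M a (π ŵ) (π v̂) (image π t , h , (v̂ , tv , refl)) (image π s) }
    }

  covering : I → IsBisimCovering M̂ M π
  covering i₀ = record
    { surjective = λ w → (w , i₀) , refl
    ; statesForth = λ a ŵ t h → h
    ; statesBack = λ a ŵ s h → preimage π s , Σa-image-preimage M π a (π ŵ) s h ,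
        (image-preimage-⊆ π s , ⊆-image-preimage-proj₁ i₀ s)
    ; valuation = λ p → image-preimage-⊆ π (V M p) , ⊆-image-preimage-proj₁ i₀ (V M p)
    ; graphBisim = λ { ŵ w refl → (λ p → mk⇔ id id) , λ a →
        (λ t h → image π t , h ,
                 (λ v tv → π v , (v , tv , refl) , refl) , (λ w (v , tv , eq) → v , tv , eq)) ,
        (λ s h → preimage π s , Σa-image-preimage M π a (π ŵ) s h ,
                 (λ v sπv → π v , sπv , refl) , (λ w sw → (w , i₀) , sw , refl)) }
    }

  extendAlongFibres : WinRegion M̂ M̂ → WinRegion M̂ M̂
  extendAlongFibres R = record
    { Yw = λ u v → ∃[ z ] (R.Yw u z × π z ≡ π v)
    ; Ys = R.Ys
    ; atoms = λ { (z , r , eq) p → mk⇔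
        (λ x → subst (V M p) eq (Equivalence.to (R.atoms r p) x))
        (λ y → Equivalence.from (R.atoms r p) (subst (V M p) (sym eq) y)) }
    ; forth = λ { (z , r , eq) a s h → let (t , h′ , st) = R.forth r a s h in
        t , subst (λ x → Σa M a x (image π t)) eq h′ , st }
    ; back = λ { (z , r , eq) a t h →
        R.back r a t (subst (λ x → Σa M a x (image π t)) (sym eq) h) }
    ; sforth = λ st v sv → let (v′ , tv′ , r) = R.sforth st v sv in
        v′ , tv′ , (v′ , r , refl)
    ; sback = λ st v′ tv′ → let (v , sv , r) = R.sback st v′ tv′ in
        v , sv , (v′ , r , refl)
    }
    where module R = WinRegion R

  Bisimilar-respects-π : ∀ {u v v′} → Bisimilar M̂ M̂ u v → π v ≡ π v′ → Bisimilar M̂ M̂ u v′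
  Bisimilar-respects-π {v = v} (R , r) eq = extendAlongFibres R , (v , r , eq)

  rich : ∀ {K} {ι : Fin K → I} → Injective _≡_ _≡_ ι → Rich K M̂
  rich {ι = ι} ι-injective a ŵ s h =
    preimage π (image π s) , (λ v sv → v , sv , refl) ,
    Σa-image-preimage M π a (π ŵ) (image π s) h ,
    λ { u _ (v , u∼v , s′v) →
        (λ k → π v , ι k) ,
        (λ eq → ι-injective (cong proj₂ eq)) ,
        (λ k → Bisimilar-respects-π u∼v refl , s′v) }

lemma9p5 : {A P : Set} (K : ℕ) (M : InqS5 A P) →
    Σ (InqS5 A P) λ M̂ → Σ (InqS5.W M̂ → InqS5.W M) λ π →
      IsBisimCovering M̂ M π × FiniteFibres π × Rich K M̂
lemma9p5 K M =
  M̂ , π , covering zero , proj₁-finiteFibres (suc K) , rich suc-injective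
  where open Inflation M (Fin (suc K))
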